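{- Let $G$ be a graph, let $H$ be a 2-edge-connected spanning subgraph of $G$ and let $T$ be a spanning tree of $H$. Let $e$ be an edge of $G$ not in $H$ and let $\{f,f'\}$ be a cut pair of $H$. Then $e$ covers the cut pair $\{f,f'\}$ if and only if exactly one of $f,f'$ belongs to $S^1_e$.
   Context: A pair of edges $\{f,f'\}$ is a cut pair in a 2-edge-connected graph if removing both disconnects it. An edge $e\notin H$ covers the cut pair $\{f,f'\}$ of $H$ if $\{f,f'\}$ is not a cut pair of $H\cup\{e\}$. For an edge $e=\{u,v\}\notin T$, $S^1_e$ denotes the set of tree edges on the unique path between $u$ and $v$ in $T$. -}

module Defs where

open import Data.Nat using (ℕ)
open import Data.Fin using (Fin)
open import Data.Fin.Subset using (Subset; _∈_; _∉_; _⊆_; _∪_; _-_; ⁅_⁆)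
open import Data.Product using (_×_; _,_; Σ; ∃; proj₁; proj₂)
open import Data.Sum using (_⊎_)
open import Data.List using (List; []; _∷_)
open import Data.List.Relation.Unary.Unique.Propositional using (Unique)
import Data.List.Membership.Propositional as LM
open import Relation.Binary.PropositionalEquality using (_≡_)
open import Relation.Nullary using (¬_)

record Graph : Set where
  field
    n    : ℕ
    m    : ℕ
    ends : Fin m → Fin n × Fin n

module _ (G : Graph) where
  open Graph G

  -- A subgraph is given by a set of edges of G (spanning: all vertices).
  EdgeSet : Set
  EdgeSet = Subset m

  Joins : Fin m → Fin n → Fin n → Set
  Joins i u w = (ends i ≡ (u , w)) ⊎ (ends i ≡ (w , u))

  data Walk (F : EdgeSet) : Fin n → Fin n → Set where
    []   : ∀ {v} → Walk F v v
    step : ∀ {u w v} (i : Fin m) → i ∈ F → Joins i u w → Walk F w v → Walk F u v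

  walkVerts : ∀ {F u v} → Walk F u v → List (Fin n)
  walkVerts {v = v} []        = v ∷ []
  walkVerts {u = u} (step i _ _ p) = u ∷ walkVerts p

  walkEdges : ∀ {F u v} → Walk F u v → List (Fin m)
  walkEdges []             = []
  walkEdges (step i _ _ p) = i ∷ walkEdges p

  IsPath : ∀ {F u v} → Walk F u v → Set
  IsPath p = Unique (walkVerts p)

  Connected : EdgeSet → Set
  Connected F = ∀ (u v : Fin n) → Walk F u v

  TwoEdgeConnected : EdgeSet → Set
  TwoEdgeConnected F = Connected F × (∀ f → f ∈ F → Connected (F - f))

  -- acyclic: every edge of F is a bridge (its endpoints are disconnected in F - f);
  -- for multigraphs this is equivalent to containing no cycle (incl. loops / parallel edges)
  Acyclic : EdgeSet → Set
  Acyclic F = ∀ f → f ∈ F → ¬ Walk (F - f) (proj₁ (ends f)) (proj₂ (ends f))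

  IsSpanningTreeOf : EdgeSet → EdgeSet → Set
  IsSpanningTreeOf T H = T ⊆ H × Connected T × Acyclic T

  IsCutPair : EdgeSet → Fin m → Fin m → Set
  IsCutPair H f f' = ¬ (f ≡ f') × f ∈ H × f' ∈ H × ¬ Connected (H - f - f')

  Covers : EdgeSet → Fin m → Fin m → Fin m → Set
  Covers H e f f' = ¬ IsCutPair (H ∪ ⁅ e ⁆) f f'

  -- t ∈ S¹_e : t lies on the (unique) path in T between the endpoints of e
  InS1 : EdgeSet → Fin m → Fin m → Set
  InS1 T e t = Σ (Walk T (proj₁ (ends e)) (proj₂ (ends e)))
                 (λ p → IsPath p × t LM.∈ walkEdges p)

module Submission where

-- For a tree edge t let side t w record which component of T - t contains w; then t ∈ S¹_e
-- exactly when the ends of e lie on different sides of t. Label every vertex by the xor of its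
-- sides with respect to f and f′, so that "exactly one of f, f′ lies in S¹_e" says that e joins
-- differently labelled vertices. The label is constant on the components of T - f - f′ and
-- changes across f and f′. Any edge set containing C = H - f - f′ together with a walk between
-- differently labelled vertices is connected: this is immediate when at most one of f, f′ is in
-- T, and when both are, the 2-edge-connectivity of H links each outer component of T - f - f′ to
-- the middle one or to the other outer one inside C. Since C itself is disconnected, none of its
-- edges joins differently labelled vertices, so C + e is connected iff the ends of e carry
-- different labels.

open import Defs
open import Data.Fin using (Fin) renaming (_≟_ to _≟ᶠ_)
open import Data.Fin.Subset using (Subset; _∈_; _∉_; _⊆_; _∪_; _-_; _─_; ⁅_⁆)
open import Data.Fin.Subset.Properties
  using (_∈?_; x∈p∧x≢y⇒x∈p-y; x∈p∪q⁺; x∈p∪q⁻; x∈⁅x⁆; x∈⁅y⁆⇒x≡y; p─q⊆p; p─x─y≡p─y─x)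
open import Data.Product using (_×_; _,_; Σ; Σ-syntax; proj₁; proj₂)
open import Data.Sum using (_⊎_; inj₁; inj₂)
open import Data.Bool using (Bool; true; false; not; _xor_)
open import Data.Bool.Properties
  using (¬-not; not-injective; not-involutive; not-distribˡ-xor; not-distribʳ-xor; xor-comm; xor-identityʳ)
  renaming (_≟_ to _≟ᵇ_)
open import Data.Vec using (_∷_; there)
import Data.List.Relation.Unary.Any as Any
open import Data.List.Relation.Unary.All using ([])
open import Data.List.Relation.Unary.All.Properties using (¬Any⇒All¬; All¬⇒¬Any)
import Data.List.Relation.Unary.AllPairs as AllPairs
import Data.List.Membership.Propositional as List
import Data.List.Membership.DecPropositional as DecList
open import Data.Empty using (⊥-elim)
open import Relation.Nullary using (¬_; Dec; yes; no; does)
open import Relation.Binary.PropositionalEquality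
open import Function using (_∘_; id)
open import Function.Bundles using (_⇔_; mk⇔)
import Function.Properties.Equivalence as ⇔

xor-cancelʳ : ∀ {a b} c → a xor c ≡ b xor c → a ≡ b
xor-cancelʳ {a} {b} false eq = begin
  a           ≡⟨ xor-identityʳ a ⟨
  a xor false ≡⟨ eq ⟩
  b xor false ≡⟨ xor-identityʳ b ⟩
  b           ∎
  where open ≡-Reasoning
xor-cancelʳ {a} {b} true eq = not-injective (begin
  not a      ≡⟨ xor-comm true a ⟩
  a xor true ≡⟨ eq ⟩
  b xor true ≡⟨ xor-comm b true ⟩
  not b      ∎)
  where open ≡-Reasoning

not-xor-not : ∀ a b → not a xor not b ≡ a xor b
not-xor-not a b = begin
  not a xor not b     ≡⟨ sym (not-distribˡ-xor a (not b)) ⟩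
  not (a xor not b)   ≡⟨ cong not (sym (not-distribʳ-xor a b)) ⟩
  not (not (a xor b)) ≡⟨ not-involutive (a xor b) ⟩
  a xor b             ∎
  where open ≡-Reasoning

xor-≢ˡ : ∀ {a b c d} → a ≢ b → c ≡ d → a xor c ≢ b xor d
xor-≢ˡ {c = c} a≢b refl eq = a≢b (xor-cancelʳ c eq)

xor-≢ʳ : ∀ {a b c d} → a ≡ b → c ≢ d → a xor c ≢ b xor d
xor-≢ʳ {a} {_} {c} {d} refl c≢d eq =
  xor-≢ˡ c≢d refl (trans (xor-comm c a) (trans eq (xor-comm a d)))

xor-≢⁻ : ∀ {a b c d} → a xor c ≢ b xor d → (a ≢ b × c ≡ d) ⊎ (a ≡ b × c ≢ d)
xor-≢⁻ {a} {b} {c} {d} ne with a ≟ᵇ b | c ≟ᵇ d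
... | yes refl | yes refl = ⊥-elim (ne refl)
... | no a≢b   | yes c≡d = inj₁ (a≢b , c≡d)
... | yes a≡b  | no c≢d  = inj₂ (a≡b , c≢d)
... | no a≢b   | no c≢d  = ⊥-elim (ne (begin
  a xor c         ≡⟨ cong₂ _xor_ (¬-not a≢b) (¬-not c≢d) ⟩
  not b xor not d ≡⟨ not-xor-not b d ⟩
  b xor d         ∎))
  where open ≡-Reasoning

≢-≢⇒≡ : ∀ {a b c : Bool} → a ≢ c → b ≢ c → a ≡ b
≢-≢⇒≡ a≢c b≢c = trans (¬-not a≢c) (sym (¬-not b≢c))

x∈p─q⇒x∉q : ∀ {k} (p q : Subset k) {x} → x ∈ p ─ q → x ∉ q
x∈p─q⇒x∉q (_ ∷ p) (_ ∷ q) (there x∈) (there x∈q) = x∈p─q⇒x∉q p q x∈ x∈q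

module _ {k} {p : Subset k} {x y : Fin k} where

  x∈p-y⇒x∈p : x ∈ p - y → x ∈ p
  x∈p-y⇒x∈p = p─q⊆p p ⁅ y ⁆

  x∈p-y⇒x≢y : x ∈ p - y → x ≢ y
  x∈p-y⇒x≢y x∈ refl = x∈p─q⇒x∉q p ⁅ y ⁆ x∈ (x∈⁅x⁆ x)

x∈p-y-z⁺ : ∀ {k} {p : Subset k} {x y z} → x ∈ p → x ≢ y → x ≢ z → x ∈ p - y - z
x∈p-y-z⁺ x∈p x≢y x≢z = x∈p∧x≢y⇒x∈p-y (x∈p∧x≢y⇒x∈p-y x∈p x≢y) x≢z

∈∧∉⇒≢ : ∀ {k} {p : Subset k} {x y} → x ∈ p → y ∉ p → x ≢ y
∈∧∉⇒≢ x∈p y∉p refl = y∉p x∈p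

x∉p⇒p⊆p-x : ∀ {k} {p : Subset k} {x} → x ∉ p → p ⊆ p - x
x∉p⇒p⊆p-x x∉p y∈p = x∈p∧x≢y⇒x∈p-y y∈p (∈∧∉⇒≢ y∈p x∉p)

p⊆q⇒p-x⊆q-x : ∀ {k} {p q : Subset k} {x} → p ⊆ q → p - x ⊆ q - x
p⊆q⇒p-x⊆q-x p⊆q y∈ = x∈p∧x≢y⇒x∈p-y (p⊆q (x∈p-y⇒x∈p y∈)) (x∈p-y⇒x≢y y∈)

p-x-y⊆p-y : ∀ {k} (p : Subset k) x y → p - x - y ⊆ p - y
p-x-y⊆p-y p x y z∈ = x∈p-y⇒x∈p (subst (_ ∈_) (p─x─y≡p─y─x p x y) z∈)

module Walks (G : Graph) where
  open Graph G
  open DecList (_≟ᶠ_ {n}) using () renaming (_∈?_ to _∈ᵛ?_)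

  src tgt : Fin m → Fin n
  src t = proj₁ (ends t)
  tgt t = proj₂ (ends t)

  Joins-ends : ∀ t → Joins G t (src t) (tgt t)
  Joins-ends t = inj₁ refl

  Joins-sym : ∀ {t u w} → Joins G t u w → Joins G t w u
  Joins-sym (inj₁ eq) = inj₂ eq
  Joins-sym (inj₂ eq) = inj₁ eq

  Joins-unique : ∀ {t u w u′ w′} → Joins G t u w → Joins G t u′ w′ →
                 (u′ ≡ u × w′ ≡ w) ⊎ (u′ ≡ w × w′ ≡ u)
  Joins-unique (inj₁ eq) (inj₁ eq′) = inj₁ (cong proj₁ (trans (sym eq′) eq) , cong proj₂ (trans (sym eq′) eq))
  Joins-unique (inj₁ eq) (inj₂ eq′) = inj₂ (cong proj₂ (trans (sym eq′) eq) , cong proj₁ (trans (sym eq′) eq))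
  Joins-unique (inj₂ eq) (inj₁ eq′) = inj₂ (cong proj₁ (trans (sym eq′) eq) , cong proj₂ (trans (sym eq′) eq))
  Joins-unique (inj₂ eq) (inj₂ eq′) = inj₁ (cong proj₂ (trans (sym eq′) eq) , cong proj₁ (trans (sym eq′) eq))

  Joins-end : ∀ {t u w u′ w′} → Joins G t u w → Joins G t u′ w′ → u′ ≡ u ⊎ u′ ≡ w
  Joins-end j j′ with Joins-unique j j′
  ... | inj₁ (eq , _) = inj₁ eq
  ... | inj₂ (eq , _) = inj₂ eq

  weaken : ∀ {F F′} → F ⊆ F′ → ∀ {a b} → Walk G F a b → Walk G F′ a b
  weaken F⊆F′ []              = []
  weaken F⊆F′ (step i i∈ j p) = step i (F⊆F′ i∈) j (weaken F⊆F′ p)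

  Connected-mono : ∀ {F F′} → F ⊆ F′ → Connected G F → Connected G F′
  Connected-mono F⊆F′ conn u v = weaken F⊆F′ (conn u v)

  infixr 5 _++ʷ_
  _++ʷ_ : ∀ {F a b c} → Walk G F a b → Walk G F b c → Walk G F a c
  []              ++ʷ q = q
  step i i∈ j p   ++ʷ q = step i i∈ j (p ++ʷ q)

  edgeʷ : ∀ {F i u w} → i ∈ F → Joins G i u w → Walk G F u w
  edgeʷ i∈ j = step _ i∈ j []

  reverseʷ : ∀ {F a b} → Walk G F a b → Walk G F b a
  reverseʷ []              = []
  reverseʷ (step i i∈ j p) = reverseʷ p ++ʷ edgeʷ i∈ (Joins-sym j)

  Joins-walk : ∀ {F t u w u′ w′} → Joins G t u w → Joins G t u′ w′ → Walk G F u w → Walk G F u′ w′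
  Joins-walk j j′ p with Joins-unique j j′
  ... | inj₁ (refl , refl) = p
  ... | inj₂ (refl , refl) = reverseʷ p

  hub⇒connected : ∀ {F c} → (∀ w → Walk G F w c) → Connected G F
  hub⇒connected to-c u v = to-c u ++ʷ reverseʷ (to-c v)

  avoid : ∀ {F a b t} (p : Walk G F a b) → ¬ t List.∈ walkEdges G p → Walk G (F - t) a b
  avoid []              _  = []
  avoid (step i i∈ j p) t∉ =
    step i (x∈p∧x≢y⇒x∈p-y i∈ λ { refl → t∉ (Any.here refl) }) j (avoid p (t∉ ∘ Any.there))

  avoid-or-reach : ∀ {F a b} t → Walk G F a b →
    Walk G (F - t) a b ⊎ Σ[ u ∈ Fin n ] Σ[ w ∈ Fin n ] Joins G t u w × Walk G (F - t) a u
  avoid-or-reach t [] = inj₁ []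
  avoid-or-reach t (step i i∈ j p) with i ≟ᶠ t
  ... | yes refl = inj₂ (_ , _ , j , [])
  ... | no i≢t with avoid-or-reach t p
  ...   | inj₁ q               = inj₁ (step i (x∈p∧x≢y⇒x∈p-y i∈ i≢t) j q)
  ...   | inj₂ (u , w , j′ , q) = inj₂ (u , w , j′ , step i (x∈p∧x≢y⇒x∈p-y i∈ i≢t) j q)

  reach-edge : ∀ {F v a b t} → Walk G F v a → Joins G t a b →
    Σ[ u ∈ Fin n ] Σ[ w ∈ Fin n ] Joins G t u w × Walk G (F - t) v u
  reach-edge {t = t} p j with avoid-or-reach t p
  ... | inj₁ q = _ , _ , j , q
  ... | inj₂ r = r

  reach-either-end : ∀ {F v a b t} → Walk G F v a → Joins G t a b →
    Walk G (F - t) v a ⊎ Walk G (F - t) v b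
  reach-either-end p j with reach-edge p j
  ... | u , w , j′ , q with Joins-end j j′
  ...   | inj₁ refl = inj₁ q
  ...   | inj₂ refl = inj₂ q

  crossing-edge : (ℓ : Fin n → Bool) → ∀ {F a b} → Walk G F a b → ℓ a ≢ ℓ b →
    Σ[ g ∈ Fin m ] Σ[ u ∈ Fin n ] Σ[ w ∈ Fin n ] g ∈ F × Joins G g u w × ℓ u ≢ ℓ w
  crossing-edge ℓ [] ne = ⊥-elim (ne refl)
  crossing-edge ℓ {a = a} (step {w = w} i i∈ j p) ne with ℓ a ≟ᵇ ℓ w
  ... | yes eq = crossing-edge ℓ p (ne ∘ trans eq)
  ... | no ne′ = i , a , w , i∈ , j , ne′

  head∈walkVerts : ∀ {F a b} (p : Walk G F a b) → a List.∈ walkVerts G p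
  head∈walkVerts []             = Any.here refl
  head∈walkVerts (step _ _ _ _) = Any.here refl

  end∈walkVerts : ∀ {F a b t u w} (p : Walk G F a b) → t List.∈ walkEdges G p →
                  Joins G t u w → u List.∈ walkVerts G p
  end∈walkVerts (step i i∈ j p) (Any.here refl) j′ with Joins-end j j′
  ... | inj₁ refl = Any.here refl
  ... | inj₂ refl = Any.there (head∈walkVerts p)
  end∈walkVerts (step i i∈ j p) (Any.there t∈) j′ = Any.there (end∈walkVerts p t∈ j′)

  suffix-path : ∀ {F u a b} (p : Walk G F a b) → IsPath G p → u List.∈ walkVerts G p →
                Σ (Walk G F u b) (IsPath G)
  suffix-path []              p-path   (Any.here refl) = [] , p-path
  suffix-path (step i i∈ j p) p-path   (Any.here refl) = step i i∈ j p , p-path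
  suffix-path (step i i∈ j p) (_ AllPairs.∷ p-path) (Any.there u∈) = suffix-path p p-path u∈

  loop-erase : ∀ {F a b} → Walk G F a b → Σ (Walk G F a b) (IsPath G)
  loop-erase [] = [] , ([] AllPairs.∷ AllPairs.[])
  loop-erase {a = a} (step i i∈ j p) with loop-erase p
  ... | q , q-path with a ∈ᵛ? walkVerts G q
  ...   | yes a∈ = suffix-path q q-path a∈
  ...   | no a∉  = step i i∈ j q , (¬Any⇒All¬ _ a∉ AllPairs.∷ q-path)

module SpanningTree (G : Graph) (T : EdgeSet G) (T-connected : Connected G T) (T-acyclic : Acyclic G T) where
  open Graph G
  open Walks G
  open DecList (_≟ᶠ_ {m}) using () renaming (_∈?_ to _∈ᵉ?_)

  tree-split : ∀ t w → Walk G (T - t) w (src t) ⊎ Walk G (T - t) w (tgt t)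
  tree-split t w = reach-either-end (T-connected w (src t)) (Joins-ends t)

  far⇒tgt : ∀ {t w} → ¬ Walk G (T - t) w (src t) → Walk G (T - t) w (tgt t)
  far⇒tgt {t} {w} ¬near with tree-split t w
  ... | inj₁ near = ⊥-elim (¬near near)
  ... | inj₂ far  = far

  near? : ∀ t w → Dec (Walk G (T - t) w (src t))
  near? t w with t ∈? T | tree-split t w
  ... | no t∉T | _        = yes (weaken (x∉p⇒p⊆p-x t∉T) (T-connected w (src t)))
  ... | yes _  | inj₁ near = yes near
  ... | yes t∈T | inj₂ far = no λ near → T-acyclic t t∈T (reverseʷ near ++ʷ far)

  side : Fin m → Fin n → Bool
  side t w = does (near? t w)

  walk⇒side≡ : ∀ {t a b} → Walk G (T - t) a b → side t a ≡ side t b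
  walk⇒side≡ {t} {a} {b} p with near? t a | near? t b
  ... | yes _     | yes _     = refl
  ... | no _      | no _      = refl
  ... | yes a-near | no ¬b-near = ⊥-elim (¬b-near (reverseʷ p ++ʷ a-near))
  ... | no ¬a-near | yes b-near = ⊥-elim (¬a-near (p ++ʷ b-near))

  side≡⇒walk : ∀ {t a b} → side t a ≡ side t b → Walk G (T - t) a b
  side≡⇒walk {t} {a} {b} eq with near? t a | near? t b
  ... | yes a-near | yes b-near = a-near ++ʷ reverseʷ b-near
  ... | no ¬a-near | no ¬b-near = far⇒tgt ¬a-near ++ʷ reverseʷ (far⇒tgt ¬b-near)

  side-const : ∀ {t a b} → t ∉ T → side t a ≡ side t b
  side-const {a = a} {b} t∉T = walk⇒side≡ (weaken (x∉p⇒p⊆p-x t∉T) (T-connected a b))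

  side-flips : ∀ {t u w} → t ∈ T → Joins G t u w → side t u ≢ side t w
  side-flips {t} t∈T j eq = T-acyclic t t∈T (Joins-walk j (Joins-ends t) (side≡⇒walk eq))

  side-stable : ∀ {t t′ u w} → t′ ∈ T → t′ ≢ t → Joins G t′ u w → side t u ≡ side t w
  side-stable t′∈T t′≢t j = walk⇒side≡ (edgeʷ (x∈p∧x≢y⇒x∈p-y t′∈T t′≢t) j)

  bridge-crossing : ∀ {X t a b} → T - t ⊆ X → Walk G X a b → side t a ≢ side t b → Connected G X
  bridge-crossing {X} {t} T-t⊆X p ne = hub⇒connected to-src
    where
    lift : ∀ {u w} → Walk G (T - t) u w → Walk G X u w
    lift = weaken T-t⊆X

    tgt→src : ∀ {a b} → Walk G X a b → side t a ≢ side t b → Walk G X (tgt t) (src t)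
    tgt→src {a} {b} p ne with near? t a | near? t b
    ... | yes _      | yes _      = ⊥-elim (ne refl)
    ... | no _       | no _       = ⊥-elim (ne refl)
    ... | yes a-near | no ¬b-near = reverseʷ (lift (far⇒tgt ¬b-near)) ++ʷ reverseʷ p ++ʷ lift a-near
    ... | no ¬a-near | yes b-near = reverseʷ (lift (far⇒tgt ¬a-near)) ++ʷ p ++ʷ lift b-near

    to-src : ∀ w → Walk G X w (src t)
    to-src w with near? t w
    ... | yes near = lift near
    ... | no ¬near = lift (far⇒tgt ¬near) ++ʷ tgt→src p ne

  path-edge-separates : ∀ {a b t} (p : Walk G T a b) → IsPath G p → t List.∈ walkEdges G p →
                        ¬ Walk G (T - t) a b
  path-edge-separates {t = t} (step i i∈ j p) (a∉p AllPairs.∷ p-path) t∈p q with i ≟ᶠ t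
  ... | no i≢t = path-edge-separates p p-path (t∈tail t∈p) (reverseʷ (edgeʷ (x∈p∧x≢y⇒x∈p-y i∈ i≢t) j) ++ʷ q)
    where
    t∈tail : t List.∈ walkEdges G (step i i∈ j p) → t List.∈ walkEdges G p
    t∈tail (Any.here refl) = ⊥-elim (i≢t refl)
    t∈tail (Any.there t∈) = t∈
  ... | yes refl with t ∈ᵉ? walkEdges G p
  ...   | yes t∈p′ = All¬⇒¬Any a∉p (end∈walkVerts p t∈p′ j)
  ...   | no t∉p′  = T-acyclic t i∈ (Joins-walk j (Joins-ends t) (q ++ʷ reverseʷ (avoid p t∉p′)))

  InS1⇒side≢ : ∀ {e t} → InS1 G T e t → side t (src e) ≢ side t (tgt e)
  InS1⇒side≢ (p , p-path , t∈p) eq = path-edge-separates p p-path t∈p (side≡⇒walk eq)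

  side≢⇒InS1 : ∀ {e t} → side t (src e) ≢ side t (tgt e) → InS1 G T e t
  side≢⇒InS1 {e} {t} ne with loop-erase (T-connected (src e) (tgt e))
  ... | p , p-path with t ∈ᵉ? walkEdges G p
  ...   | yes t∈p = p , p-path , t∈p
  ...   | no t∉p  = ⊥-elim (ne (walk⇒side≡ (avoid p t∉p)))

  ¬InS1⇒side≡ : ∀ {e t} → ¬ InS1 G T e t → side t (src e) ≡ side t (tgt e)
  ¬InS1⇒side≡ {e} {t} ∉S with side t (src e) ≟ᵇ side t (tgt e)
  ... | yes eq = eq
  ... | no ne  = ⊥-elim (∉S (side≢⇒InS1 ne))

module CutPair (G : Graph) (H T : EdgeSet G)
  (H-bridgeless : ∀ g → g ∈ H → Connected G (H - g))
  (T⊆H : T ⊆ H) (T-connected : Connected G T) (T-acyclic : Acyclic G T)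
  {f f′ : Fin (Graph.m G)} (f≢f′ : f ≢ f′) where
  open Graph G
  open Walks G
  open SpanningTree G T T-connected T-acyclic

  label : Fin n → Bool
  label w = side f w xor side f′ w

  C : EdgeSet G
  C = H - f - f′

  D : EdgeSet G
  D = T - f - f′

  H-f′-f⊆C : H - f′ - f ⊆ C
  H-f′-f⊆C = subst (_ ∈_) (p─x─y≡p─y─x H f′ f)

  D⊆C : D ⊆ C
  D⊆C = p⊆q⇒p-x⊆q-x (p⊆q⇒p-x⊆q-x T⊆H)

  label-D-invariant : ∀ {a b} → Walk G D a b → label a ≡ label b
  label-D-invariant p = cong₂ _xor_ (walk⇒side≡ (weaken x∈p-y⇒x∈p p))
                                    (walk⇒side≡ (weaken (p-x-y⊆p-y T f f′) p))

  label-flips-at-f : f ∈ T → ∀ {u w} → Joins G f u w → label u ≢ label w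
  label-flips-at-f f∈T j = xor-≢ˡ (side-flips f∈T j) (side-stable f∈T f≢f′ j)

  label-flips-at-f′ : f′ ∈ T → ∀ {u w} → Joins G f′ u w → label u ≢ label w
  label-flips-at-f′ f′∈T j = xor-≢ʳ (side-stable f′∈T (f≢f′ ∘ sym) j) (side-flips f′∈T j)

  module BothInTree (f∈T : f ∈ T) (f′∈T : f′ ∈ T) where

    linked-ends : Σ[ q ∈ Fin n ] Σ[ p ∈ Fin n ] Σ[ r ∈ Fin n ] Σ[ s ∈ Fin n ]
                  Joins G f q p × Joins G f′ r s × Walk G D q r
    linked-ends with reach-edge (T-connected (src f′) (src f)) (Joins-ends f)
    ... | q , p , jf , to-q with reach-edge (reverseʷ to-q) (Joins-ends f′)
    ...   | r , s , jf′ , mid = q , p , r , s , jf , jf′ , mid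

    -- q and r lie in the middle component of T - f - f′, p and s in the two outer ones
    module Linked {q p r s} (jf : Joins G f q p) (jf′ : Joins G f′ r s) (mid : Walk G D q r) where

      label-p≡label-s : label p ≡ label s
      label-p≡label-s = ≢-≢⇒≡ (≢-sym (label-flips-at-f f∈T jf)) label-s≢label-q
        where
        label-s≢label-q : label s ≢ label q
        label-s≢label-q eq = label-flips-at-f′ f′∈T jf′ (trans (sym (label-D-invariant mid)) (sym eq))

      Outer : Fin n → Set
      Outer w = Walk G D w p ⊎ Walk G D w s

      label-Outer : ∀ {w} → Outer w → label w ≡ label p
      label-Outer (inj₁ to-p) = label-D-invariant to-p
      label-Outer (inj₂ to-s) = trans (label-D-invariant to-s) (sym label-p≡label-s)

      avoid-f′ : ∀ {w z} → Walk G (T - f) w z → Walk G D w z ⊎ Walk G D w q ⊎ Walk G D w s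
      avoid-f′ to-z with avoid-or-reach f′ to-z
      ... | inj₁ to-z′ = inj₁ to-z′
      ... | inj₂ (u , _ , j , to-u) with Joins-end jf′ j
      ...   | inj₁ refl = inj₂ (inj₁ (to-u ++ʷ reverseʷ mid))
      ...   | inj₂ refl = inj₂ (inj₂ to-u)

      trichotomy : ∀ w → Walk G D w q ⊎ Outer w
      trichotomy w with reach-either-end (T-connected w q) jf
      ... | inj₁ to-q with avoid-f′ to-q
      ...   | inj₁ d        = inj₁ d
      ...   | inj₂ (inj₁ d) = inj₁ d
      ...   | inj₂ (inj₂ d) = inj₂ (inj₂ d)
      trichotomy w | inj₂ to-p with avoid-f′ to-p
      ...   | inj₁ d        = inj₂ (inj₁ d)
      ...   | inj₂ (inj₁ d) = inj₁ d
      ...   | inj₂ (inj₂ d) = inj₂ (inj₂ d)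

      p-link : Walk G C p q ⊎ Walk G C p s
      p-link with reach-either-end (H-bridgeless f (T⊆H f∈T) p r) jf′
      ... | inj₁ to-r = inj₁ (to-r ++ʷ reverseʷ (weaken D⊆C mid))
      ... | inj₂ to-s = inj₂ to-s

      s-link : Walk G C s q ⊎ Walk G C s p
      s-link with reach-either-end (H-bridgeless f′ (T⊆H f′∈T) s q) jf
      ... | inj₁ to-q = inj₁ (weaken H-f′-f⊆C to-q)
      ... | inj₂ to-p = inj₂ (weaken H-f′-f⊆C to-p)

      module _ {X} (C⊆X : C ⊆ X) where

        liftD : ∀ {a b} → Walk G D a b → Walk G X a b
        liftD = weaken (C⊆X ∘ D⊆C)

        from-Outer : ∀ {w} → Outer w → Walk G X w q → Walk G X p q ⊎ Walk G X s q
        from-Outer (inj₁ w-p) w-q = inj₁ (reverseʷ (liftD w-p) ++ʷ w-q)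
        from-Outer (inj₂ w-s) w-q = inj₂ (reverseʷ (liftD w-s) ++ʷ w-q)

        crossing-reaches-middle : ∀ {a b} → Walk G X a b → label a ≢ label b →
                                  Walk G X p q ⊎ Walk G X s q
        crossing-reaches-middle {a} {b} to-b ne with trichotomy a | trichotomy b
        ... | inj₁ a-q | inj₁ b-q = ⊥-elim (ne (trans (label-D-invariant a-q) (sym (label-D-invariant b-q))))
        ... | inj₂ a-o | inj₂ b-o = ⊥-elim (ne (trans (label-Outer a-o) (sym (label-Outer b-o))))
        ... | inj₂ a-o | inj₁ b-q = from-Outer a-o (to-b ++ʷ liftD b-q)
        ... | inj₁ a-q | inj₂ b-o = from-Outer b-o (reverseʷ to-b ++ʷ liftD a-q)

        outer-reach-middle : Walk G X p q ⊎ Walk G X s q → Walk G X p q × Walk G X s q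
        outer-reach-middle (inj₁ p-q) with s-link
        ... | inj₁ s-q = p-q , weaken C⊆X s-q
        ... | inj₂ s-p = p-q , weaken C⊆X s-p ++ʷ p-q
        outer-reach-middle (inj₂ s-q) with p-link
        ... | inj₁ p-q = weaken C⊆X p-q , s-q
        ... | inj₂ p-s = weaken C⊆X p-s ++ʷ s-q , s-q

        crossing-connects : ∀ {a b} → Walk G X a b → label a ≢ label b → Connected G X
        crossing-connects to-b ne = hub⇒connected to-q
          where
          outer-to-q : Walk G X p q × Walk G X s q
          outer-to-q = outer-reach-middle (crossing-reaches-middle to-b ne)

          to-q : ∀ w → Walk G X w q
          to-q w with trichotomy w
          ... | inj₁ w-q        = liftD w-q
          ... | inj₂ (inj₁ w-p) = liftD w-p ++ʷ proj₁ outer-to-q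
          ... | inj₂ (inj₂ w-s) = liftD w-s ++ʷ proj₂ outer-to-q

    crossing-connects : ∀ {X} → C ⊆ X → ∀ {a b} → Walk G X a b → label a ≢ label b → Connected G X
    crossing-connects with linked-ends
    ... | _ , _ , _ , _ , jf , jf′ , mid = Linked.crossing-connects jf jf′ mid

  T⊆C : f ∉ T → f′ ∉ T → T ⊆ C
  T⊆C f∉T f′∉T t∈ = x∈p-y-z⁺ (T⊆H t∈) (∈∧∉⇒≢ t∈ f∉T) (∈∧∉⇒≢ t∈ f′∉T)

  T-f⊆C : f′ ∉ T → T - f ⊆ C
  T-f⊆C f′∉T t∈ = x∈p-y-z⁺ (T⊆H (x∈p-y⇒x∈p t∈)) (x∈p-y⇒x≢y t∈) (∈∧∉⇒≢ (x∈p-y⇒x∈p t∈) f′∉T)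

  T-f′⊆C : f ∉ T → T - f′ ⊆ C
  T-f′⊆C f∉T t∈ = x∈p-y-z⁺ (T⊆H (x∈p-y⇒x∈p t∈)) (∈∧∉⇒≢ (x∈p-y⇒x∈p t∈) f∉T) (x∈p-y⇒x≢y t∈)

  crossing-connects : ∀ {X} → C ⊆ X → ∀ {a b} → Walk G X a b → label a ≢ label b → Connected G X
  crossing-connects {X} C⊆X {a} {b} p ne = by-cases (f ∈? T) (f′ ∈? T)
    where
    by-cases : Dec (f ∈ T) → Dec (f′ ∈ T) → Connected G X
    by-cases (yes f∈T) (yes f′∈T) = BothInTree.crossing-connects f∈T f′∈T C⊆X p ne
    by-cases (yes _)   (no f′∉T)  =
      bridge-crossing (C⊆X ∘ T-f⊆C f′∉T) p (λ eq → ne (cong₂ _xor_ eq (side-const f′∉T)))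
    by-cases (no f∉T)  (yes _)    =
      bridge-crossing (C⊆X ∘ T-f′⊆C f∉T) p (λ eq → ne (cong₂ _xor_ (side-const f∉T) eq))
    by-cases (no f∉T)  (no f′∉T)  = Connected-mono (C⊆X ∘ T⊆C f∉T f′∉T) T-connected

  ¬connected⇒label-varies : ¬ Connected G C → Σ[ u ∈ Fin n ] Σ[ w ∈ Fin n ] label u ≢ label w
  ¬connected⇒label-varies ¬conn = by-cases (f ∈? T) (f′ ∈? T)
    where
    by-cases : Dec (f ∈ T) → Dec (f′ ∈ T) → Σ[ u ∈ Fin n ] Σ[ w ∈ Fin n ] label u ≢ label w
    by-cases (yes f∈T) _          = src f , tgt f , label-flips-at-f f∈T (Joins-ends f)
    by-cases (no _)    (yes f′∈T) = src f′ , tgt f′ , label-flips-at-f′ f′∈T (Joins-ends f′)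
    by-cases (no f∉T)  (no f′∉T)  = ⊥-elim (¬conn (Connected-mono (T⊆C f∉T f′∉T) T-connected))

  label≢⇔InS1-xor : ∀ {e} → label (src e) ≢ label (tgt e) ⇔
    ((InS1 G T e f × ¬ InS1 G T e f′) ⊎ (¬ InS1 G T e f × InS1 G T e f′))
  label≢⇔InS1-xor = mk⇔ to from
    where
    to : ∀ {e} → label (src e) ≢ label (tgt e) →
         (InS1 G T e f × ¬ InS1 G T e f′) ⊎ (¬ InS1 G T e f × InS1 G T e f′)
    to ne with xor-≢⁻ ne
    ... | inj₁ (f-side≢ , f′-side≡) = inj₁ (side≢⇒InS1 f-side≢ , λ ∈S → InS1⇒side≢ ∈S f′-side≡)
    ... | inj₂ (f-side≡ , f′-side≢) = inj₂ ((λ ∈S → InS1⇒side≢ ∈S f-side≡) , side≢⇒InS1 f′-side≢)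

    from : ∀ {e} → (InS1 G T e f × ¬ InS1 G T e f′) ⊎ (¬ InS1 G T e f × InS1 G T e f′) →
           label (src e) ≢ label (tgt e)
    from (inj₁ (∈S , ∉S′)) = xor-≢ˡ (InS1⇒side≢ ∈S) (¬InS1⇒side≡ ∉S′)
    from (inj₂ (∉S , ∈S′)) = xor-≢ʳ (¬InS1⇒side≡ ∉S) (InS1⇒side≢ ∈S′)

  module Adding {e} (e∉H : e ∉ H) (f∈H : f ∈ H) (f′∈H : f′ ∈ H) where

    C′ : EdgeSet G
    C′ = H ∪ ⁅ e ⁆ - f - f′

    H⊆H∪e : H ⊆ H ∪ ⁅ e ⁆
    H⊆H∪e h = x∈p∪q⁺ (inj₁ h)

    C⊆C′ : C ⊆ C′
    C⊆C′ = p⊆q⇒p-x⊆q-x (p⊆q⇒p-x⊆q-x H⊆H∪e)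

    e∈C′ : e ∈ C′
    e∈C′ = x∈p-y-z⁺ (x∈p∪q⁺ (inj₂ (x∈⁅x⁆ e))) (∈∧∉⇒≢ f∈H e∉H ∘ sym) (∈∧∉⇒≢ f′∈H e∉H ∘ sym)

    ∈C′⇒∈C : ∀ {t} → t ∈ C′ → t ≢ e → t ∈ C
    ∈C′⇒∈C t∈ t≢e with x∈p∪q⁻ H ⁅ e ⁆ (x∈p-y⇒x∈p (x∈p-y⇒x∈p t∈))
    ... | inj₁ t∈H = x∈p-y-z⁺ t∈H (x∈p-y⇒x≢y (x∈p-y⇒x∈p t∈)) (x∈p-y⇒x≢y t∈)
    ... | inj₂ t∈e = ⊥-elim (t≢e (x∈⁅y⁆⇒x≡y e t∈e))

    label≡⇒¬connected : label (src e) ≡ label (tgt e) → ¬ Connected G C → ¬ Connected G C′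
    label≡⇒¬connected eq ¬conn conn′ with ¬connected⇒label-varies ¬conn
    ... | u , w , ne with crossing-edge label (conn′ u w) ne
    ...   | g , a , b , g∈C′ , j , ne′ with g ≟ᶠ e
    ...     | no g≢e  = ¬conn (crossing-connects id (edgeʷ (∈C′⇒∈C g∈C′ g≢e) j) ne′)
    ...     | yes refl with Joins-unique (Joins-ends e) j
    ...       | inj₁ (refl , refl) = ne′ eq
    ...       | inj₂ (refl , refl) = ne′ (sym eq)

    covers⇔label≢ : ¬ Connected G C → Covers G H e f f′ ⇔ label (src e) ≢ label (tgt e)
    covers⇔label≢ ¬conn = mk⇔ to from
      where
      to : Covers G H e f f′ → label (src e) ≢ label (tgt e)
      to covers eq = covers (f≢f′ , H⊆H∪e f∈H , H⊆H∪e f′∈H , label≡⇒¬connected eq ¬conn)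

      from : label (src e) ≢ label (tgt e) → Covers G H e f f′
      from ne (_ , _ , _ , ¬conn′) = ¬conn′ (crossing-connects C⊆C′ (edgeʷ e∈C′ (Joins-ends e)) ne)

corollary2 : (G : Graph) (H T : EdgeSet G) →
    TwoEdgeConnected G H → IsSpanningTreeOf G T H →
    (e f f' : Fin (Graph.m G)) → e ∉ H → IsCutPair G H f f' →
    Covers G H e f f' ⇔
      ((InS1 G T e f × ¬ InS1 G T e f') ⊎ (¬ InS1 G T e f × InS1 G T e f'))
corollary2 G H T (_ , H-bridgeless) (T⊆H , T-connected , T-acyclic) e f f′ e∉H
           (f≢f′ , f∈H , f′∈H , ¬conn) =
  ⇔.trans (covers⇔label≢ ¬conn) label≢⇔InS1-xor
  where
  open CutPair G H T H-bridgeless T⊆H T-connected T-acyclic f≢f′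
  open Adding e∉H f∈H f′∈H
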